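{- Let $(\mathcal{F},\le)$ with meet and join, ground set $E$, $\rho:\mathcal{F}\to2^E$ satisfying the consecutive and submodular properties, and $r:\mathcal{F}\to\mathbb{Z}_{\ge0}$ supermodular. Let $F\subseteq E$, $E'\subseteq E\setminus F$, and $r'(S)=r(S)-|F\cap\rho(S)|$ for $S\in\mathcal{F}$. Let $x\in\mathbb{R}^{E'}$ satisfy $x(\rho(S)\cap E')\ge r'(S)$ for all $S\in\mathcal{F}$ and $x_e>0$ for all $e\in E'$. If $S,T\in\mathcal{F}$ satisfy $x(\rho(S)\cap E')=r'(S)$ and $x(\rho(T)\cap E')=r'(T)$, then $x(\rho(S\wedge T)\cap E')=r'(S\wedge T)$ and $x(\rho(S\vee T)\cap E')=r'(S\vee T)$; moreover $\chi(S)+\chi(T)=\chi(S\wedge T)+\chi(S\vee T)$, where $\chi(A)\in\{0,1\}^{E'}$ denotes the incidence vector of $\rho(A)\cap E'$.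
   Context: $(\mathcal{F},\le)$ is a nonempty poset with commutative binary operations $\wedge,\vee$ defined on all pairs such that $A\wedge B\le A,B\le A\vee B$. Consecutive property: $A\le B\le C\Rightarrow\rho(A)\cap\rho(C)\subseteq\rho(B)$. Submodularity: $\rho(A\vee B)\cup\rho(A\wedge B)\subseteq\rho(A)\cup\rho(B)$. $r$ supermodular: $r(A)+r(B)\le r(A\wedge B)+r(A\vee B)$. $x(A)=\sum_{e\in A}x_e$. -}

module Defs where

open import Data.Nat using (ℕ; zero; suc)
open import Data.Integer using (ℤ; +_; -[1+_])
open import Data.Fin using (Fin)
open import Data.Fin.Subset using (Subset; _∈_; _∉_; _⊆_; _∩_; _∪_; ∣_∣)
open import Data.Vec using ([]; _∷_)
open import Data.Bool using (true; false)
open import Data.Product using (Σ; ∃; _×_)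
open import Data.Sum using (_⊎_)
open import Relation.Nullary using (¬_)
open import Relation.Binary.PropositionalEquality using (_≡_)
open import Relation.Binary.Definitions using (Trichotomous)
open import Algebra.Structures using (IsCommutativeRing)

-- An axiomatic presentation of the real numbers: a Dedekind-complete
-- ordered field (unique up to isomorphism; the standard library has no ℝ).
record RealField : Set₁ where
  infixl 6 _+_
  infixl 7 _*_
  infix 4 _<_
  field
    ℝ : Set
    0r 1r : ℝ
    _+_ _*_ : ℝ → ℝ → ℝ
    -_ : ℝ → ℝ
    _<_ : ℝ → ℝ → Set
    isCommutativeRing : IsCommutativeRing _≡_ _+_ _*_ -_ 0r 1r
    0≢1 : ¬ (0r ≡ 1r)
    inverse : ∀ a → ¬ (a ≡ 0r) → Σ ℝ (λ b → a * b ≡ 1r)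
    <-trichotomous : Trichotomous _≡_ _<_
    <-trans : ∀ {a b c} → a < b → b < c → a < c
    +-monoˡ-< : ∀ {a b} c → a < b → a + c < b + c
    *-pos : ∀ {a b} → 0r < a → 0r < b → 0r < a * b

  infix 4 _≤_
  _≤_ : ℝ → ℝ → Set
  a ≤ b = (a < b) ⊎ (a ≡ b)

  field
    complete : (P : ℝ → Set) → ∃ P → (∃ λ u → ∀ a → P a → a ≤ u) →
               ∃ λ s → (∀ a → P a → a ≤ s) × (∀ u → (∀ a → P a → a ≤ u) → s ≤ u)

  fromℕ : ℕ → ℝ
  fromℕ zero = 0r
  fromℕ (suc n) = 1r + fromℕ n

  fromℤ : ℤ → ℝ
  fromℤ (+ n) = fromℕ n
  fromℤ -[1+ n ] = - fromℕ (suc n)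

  sumOver : ∀ {n} → Subset n → (Fin n → ℝ) → ℝ
  sumOver [] x = 0r
  sumOver (true ∷ A) x = x Fin.zero + sumOver A (λ i → x (Fin.suc i))
  sumOver (false ∷ A) x = sumOver A (λ i → x (Fin.suc i))

χ : ∀ {n} → Subset n → Fin n → ℕ
χ [] ()
χ (true ∷ A) Fin.zero = 1
χ (false ∷ A) Fin.zero = 0
χ (b ∷ A) (Fin.suc i) = χ A i

-- Consecutiveness and submodularity say that ρ(S ∧ T) ∩ ρ(S ∨ T) ⊆ ρ S ∩ ρ T and
-- ρ(S ∧ T) ∪ ρ(S ∨ T) ⊆ ρ S ∪ ρ T.  By inclusion–exclusion, every modular set function
-- with nonnegative weights, such as x(· ∩ E′) and |F ∩ ·|, then satisfies
-- f(ρ(S ∧ T)) + f(ρ(S ∨ T)) ≤ f(ρ S) + f(ρ T).  Together with tightness at S and T,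
-- feasibility at S ∧ T and S ∨ T, and supermodularity of r, this closes a cycle of
-- inequalities, all of which must therefore be equalities.  As x is strictly positive on
-- E′, equality for x forces the intersections and the unions to coincide on E′, and
-- inclusion–exclusion for incidence vectors gives χ(S) + χ(T) = χ(S ∧ T) + χ(S ∨ T).
module Submission where

open import Defs
open import Data.Nat using (ℕ)
open import Data.Integer using (ℤ; +_)
open import Data.Integer using () renaming (_-_ to _-ℤ_)
open import Data.Fin using (Fin)
open import Data.Fin.Subset using (Subset; _∈_; _∉_; _⊆_; _∩_; _∪_; ∣_∣)
open import Relation.Binary.PropositionalEquality using (_≡_)
open import Relation.Binary.Structures using (IsPartialOrder)
open import Data.Product using (_×_)
open import Data.Nat using () renaming (_+_ to _+ℕ_; _≤_ to _≤ℕ_)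

open import Algebra.Bundles using (CommutativeMonoid; CommutativeRing)
import Algebra.Properties.CommutativeSemigroup as CommutativeSemigroupProperties
import Algebra.Properties.Ring as RingProperties
open import Data.Bool using (true; false)
open import Data.Fin using (zero; suc)
open import Data.Fin.Subset.Properties
  using (x∈p∩q⁺; x∈p∩q⁻; x∈p∪q⁻; p∩q⊆p; p∩q⊆q; p⊆p∪q; drop-∷-⊆; p⊆q⇒∣p∣≤∣q∣;
         ⊆-trans; ⊆-reflexive; ∩-comm; ∪-comm; ∩-idem; ∩-distribʳ-∪; ∩-commutativeMonoid)
import Data.Integer as ℤ
import Data.Integer.Properties as ℤ
import Data.Nat as ℕ
import Data.Nat.Properties as ℕ
open import Data.Product using (_,_; proj₁; proj₂)
open import Data.Sum using (_⊎_; inj₁; inj₂; [_,_]′)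
import Data.Sum as Sum
open import Data.Vec using ([]; _∷_; here; there)
open import Function using (_∘_; id)
open import Relation.Binary.Bundles using (Poset)
open import Relation.Binary.Consequences using (tri⇒irr)
import Relation.Binary.Construct.StrictToNonStrict as StrictToNonStrict
open import Relation.Binary.Definitions using (Irreflexive; Transitive; Antisymmetric; tri<; tri≈; tri>)
open import Relation.Binary.PropositionalEquality
  using (refl; sym; trans; cong; cong₂; subst; subst₂; resp₂; isEquivalence; module ≡-Reasoning)
import Relation.Binary.Reasoning.PartialOrder as PosetReasoning
open import Relation.Nullary using (contradiction)

record Uncrossing {n : ℕ} (A B C D : Subset n) : Set where
  field
    ∩⊆∩ : C ∩ D ⊆ A ∩ B
    ∪⊆∪ : C ∪ D ⊆ A ∪ B

module _ {n : ℕ} where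

  ∩-monoˡ-⊆ : ∀ {P Q : Subset n} G → P ⊆ Q → P ∩ G ⊆ Q ∩ G
  ∩-monoˡ-⊆ {P} G P⊆Q i∈P∩G with x∈p∩q⁻ P G i∈P∩G
  ... | i∈P , i∈G = x∈p∩q⁺ (P⊆Q i∈P , i∈G)

  ∩-distribʳ-∩ : ∀ (G P Q : Subset n) → (P ∩ G) ∩ (Q ∩ G) ≡ (P ∩ Q) ∩ G
  ∩-distribʳ-∩ G P Q = trans (interchange P G Q G) (cong ((P ∩ Q) ∩_) (∩-idem G))
    where open CommutativeSemigroupProperties
            (CommutativeMonoid.commutativeSemigroup (∩-commutativeMonoid n)) using (interchange)

  Uncrossing-∩ʳ : ∀ {A B C D : Subset n} G → Uncrossing A B C D →
                  Uncrossing (A ∩ G) (B ∩ G) (C ∩ G) (D ∩ G)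
  Uncrossing-∩ʳ {A} {B} {C} {D} G u = record
    { ∩⊆∩ = subst₂ _⊆_ (sym (∩-distribʳ-∩ G C D)) (sym (∩-distribʳ-∩ G A B)) (∩-monoˡ-⊆ G ∩⊆∩)
    ; ∪⊆∪ = subst₂ _⊆_ (∩-distribʳ-∪ G C D) (∩-distribʳ-∪ G A B) (∩-monoˡ-⊆ G ∪⊆∪)
    }
    where open Uncrossing u

  Uncrossing-∩ˡ : ∀ {A B C D : Subset n} G → Uncrossing A B C D →
                  Uncrossing (G ∩ A) (G ∩ B) (G ∩ C) (G ∩ D)
  Uncrossing-∩ˡ {A} {B} {C} {D} G u
    rewrite ∩-comm G A | ∩-comm G B | ∩-comm G C | ∩-comm G D = Uncrossing-∩ʳ G u

χ-modular : ∀ {n} (P Q : Subset n) i → χ (P ∩ Q) i +ℕ χ (P ∪ Q) i ≡ χ P i +ℕ χ Q i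
χ-modular (true  ∷ P) (true  ∷ Q) zero    = refl
χ-modular (true  ∷ P) (false ∷ Q) zero    = refl
χ-modular (false ∷ P) (true  ∷ Q) zero    = refl
χ-modular (false ∷ P) (false ∷ Q) zero    = refl
χ-modular (true  ∷ P) (true  ∷ Q) (suc i) = χ-modular P Q i
χ-modular (true  ∷ P) (false ∷ Q) (suc i) = χ-modular P Q i
χ-modular (false ∷ P) (true  ∷ Q) (suc i) = χ-modular P Q i
χ-modular (false ∷ P) (false ∷ Q) (suc i) = χ-modular P Q i

∩-∪-determine-χ+χ : ∀ {n} {A B C D : Subset n} → C ∩ D ≡ A ∩ B → C ∪ D ≡ A ∪ B →
                    ∀ i → χ A i +ℕ χ B i ≡ χ C i +ℕ χ D i
∩-∪-determine-χ+χ {A = A} {B} {C} {D} C∩D≡A∩B C∪D≡A∪B i = begin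
  χ A i +ℕ χ B i              ≡⟨ sym (χ-modular A B i) ⟩
  χ (A ∩ B) i +ℕ χ (A ∪ B) i  ≡⟨ cong₂ (λ P Q → χ P i +ℕ χ Q i) (sym C∩D≡A∩B) (sym C∪D≡A∪B) ⟩
  χ (C ∩ D) i +ℕ χ (C ∪ D) i  ≡⟨ χ-modular C D i ⟩
  χ C i +ℕ χ D i              ∎
  where open ≡-Reasoning

∣∣-modular : ∀ {n} (P Q : Subset n) → ∣ P ∩ Q ∣ +ℕ ∣ P ∪ Q ∣ ≡ ∣ P ∣ +ℕ ∣ Q ∣
∣∣-modular []          []          = refl
∣∣-modular (true  ∷ P) (true  ∷ Q) =
  cong ℕ.suc (trans (ℕ.+-suc _ _) (trans (cong ℕ.suc (∣∣-modular P Q)) (sym (ℕ.+-suc _ _))))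
∣∣-modular (true  ∷ P) (false ∷ Q) = trans (ℕ.+-suc _ _) (cong ℕ.suc (∣∣-modular P Q))
∣∣-modular (false ∷ P) (true  ∷ Q) =
  trans (ℕ.+-suc _ _) (trans (cong ℕ.suc (∣∣-modular P Q)) (sym (ℕ.+-suc _ _)))
∣∣-modular (false ∷ P) (false ∷ Q) = ∣∣-modular P Q

∣∣-uncrossing : ∀ {n} {A B C D : Subset n} → Uncrossing A B C D →
                ∣ C ∣ +ℕ ∣ D ∣ ≤ℕ ∣ A ∣ +ℕ ∣ B ∣
∣∣-uncrossing {A = A} {B} {C} {D} u = begin
  ∣ C ∣ +ℕ ∣ D ∣              ≡⟨ ∣∣-modular C D ⟨
  ∣ C ∩ D ∣ +ℕ ∣ C ∪ D ∣      ≤⟨ ℕ.+-mono-≤ (p⊆q⇒∣p∣≤∣q∣ ∩⊆∩) (p⊆q⇒∣p∣≤∣q∣ ∪⊆∪) ⟩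
  ∣ A ∩ B ∣ +ℕ ∣ A ∪ B ∣      ≡⟨ ∣∣-modular A B ⟩
  ∣ A ∣ +ℕ ∣ B ∣              ∎
  where
  open Uncrossing u
  open ℕ.≤-Reasoning

consecutive∧submodular⇒uncrossing : ∀ {𝓕 : Set} {n} (_⊑_ : 𝓕 → 𝓕 → Set) (_∧_ _∨_ : 𝓕 → 𝓕 → 𝓕) →
  (∀ A B → (A ∧ B) ≡ (B ∧ A)) → (∀ A B → (A ∨ B) ≡ (B ∨ A)) →
  (∀ A B → (A ∧ B) ⊑ A) → (∀ A B → A ⊑ (A ∨ B)) →
  (ρ : 𝓕 → Subset n) →
  (∀ A B C → A ⊑ B → B ⊑ C → (ρ A ∩ ρ C) ⊆ ρ B) →
  (∀ A B → (ρ (A ∨ B) ∪ ρ (A ∧ B)) ⊆ (ρ A ∪ ρ B)) →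
  ∀ S T → Uncrossing (ρ S) (ρ T) (ρ (S ∧ T)) (ρ (S ∨ T))
consecutive∧submodular⇒uncrossing _⊑_ _∧_ _∨_ ∧-comm ∨-comm ∧-lowerˡ ∨-upperˡ ρ consecutive submodular S T =
  record
    { ∩⊆∩ = λ i∈ → x∈p∩q⁺ ( consecutive (S ∧ T) S (S ∨ T) (∧-lowerˡ S T) (∨-upperˡ S T) i∈
                           , consecutive (S ∧ T) T (S ∨ T) S∧T⊑T T⊑S∨T i∈ )
    ; ∪⊆∪ = ⊆-trans (⊆-reflexive (∪-comm (ρ (S ∧ T)) (ρ (S ∨ T)))) (submodular S T)
    }
  where
  S∧T⊑T : (S ∧ T) ⊑ T
  S∧T⊑T = subst (_⊑ T) (∧-comm T S) (∧-lowerˡ T S)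
  T⊑S∨T : T ⊑ (S ∨ T)
  T⊑S∨T = subst (T ⊑_) (∨-comm T S) (∨-upperˡ T S)

module OrderedFieldProperties (R : RealField) where

  open RealField R

  commutativeRing : CommutativeRing _ _
  commutativeRing = record { isCommutativeRing = isCommutativeRing }

  open CommutativeRing commutativeRing
    using (+-comm; +-assoc; +-identityˡ; +-identityʳ; -‿inverseˡ; -‿inverseʳ; ring; +-commutativeSemigroup)
  open CommutativeSemigroupProperties +-commutativeSemigroup using (interchange; x∙yz≈y∙xz)
  open RingProperties ring using (-1*x≈-x; -‿involutive; +-cancelˡ; +-cancelʳ)

  <-irrefl : Irreflexive _≡_ _<_
  <-irrefl = tri⇒irr <-trichotomous

  ≤-trans : Transitive _≤_
  ≤-trans = StrictToNonStrict.trans _≡_ _<_ isEquivalence (resp₂ _<_) <-trans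

  ≤-antisym : Antisymmetric _≡_ _≤_
  ≤-antisym = StrictToNonStrict.antisym _≡_ _<_ isEquivalence <-trans <-irrefl

  ≤-poset : Poset _ _ _
  ≤-poset = record
    { isPartialOrder = record
      { isPreorder = record { isEquivalence = isEquivalence ; reflexive = inj₂ ; trans = ≤-trans }
      ; antisym = ≤-antisym
      }
    }

  +-monoʳ-< : ∀ c {a b} → a < b → c + a < c + b
  +-monoʳ-< c {a} {b} a<b = subst₂ _<_ (+-comm a c) (+-comm b c) (+-monoˡ-< c a<b)

  +-mono-<-≤ : ∀ {a b c d} → a < b → c ≤ d → a + c < b + d
  +-mono-<-≤ {b = b} a<b (inj₁ c<d) = <-trans (+-monoˡ-< _ a<b) (+-monoʳ-< b c<d)
  +-mono-<-≤ a<b (inj₂ refl) = +-monoˡ-< _ a<b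

  +-mono-≤ : ∀ {a b c d} → a ≤ b → c ≤ d → a + c ≤ b + d
  +-mono-≤ (inj₁ a<b)  c≤d         = inj₁ (+-mono-<-≤ a<b c≤d)
  +-mono-≤ (inj₂ refl) (inj₁ c<d)  = inj₁ (+-monoʳ-< _ c<d)
  +-mono-≤ (inj₂ refl) (inj₂ refl) = inj₂ refl

  +-mono-≤-≡⇒≡ : ∀ {a b c d} → a ≤ b → c ≤ d → a + c ≡ b + d → a ≡ b × c ≡ d
  +-mono-≤-≡⇒≡ (inj₁ a<b)  c≤d a+c≡b+d = contradiction (+-mono-<-≤ a<b c≤d) (<-irrefl a+c≡b+d)
  +-mono-≤-≡⇒≡ (inj₂ refl) _   a+c≡a+d = refl , +-cancelˡ _ _ _ a+c≡a+d

  0<1 : 0r < 1r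
  0<1 with <-trichotomous 0r 1r
  ... | tri< 0<1 _ _ = 0<1
  ... | tri≈ _ 0≡1 _ = contradiction 0≡1 0≢1
  ... | tri> _ _ 1<0 = contradiction (<-trans 1<0 0<[-1]*[-1]) (<-irrefl 1≡[-1]*[-1])
    where
    0<-1 : 0r < - 1r
    0<-1 = subst₂ _<_ (-‿inverseʳ 1r) (+-identityˡ (- 1r)) (+-monoˡ-< (- 1r) 1<0)
    0<[-1]*[-1] : 0r < - 1r * - 1r
    0<[-1]*[-1] = *-pos 0<-1 0<-1
    1≡[-1]*[-1] : 1r ≡ - 1r * - 1r
    1≡[-1]*[-1] = sym (trans (-1*x≈-x (- 1r)) (-‿involutive 1r))

  fromℕ-+ : ∀ m n → fromℕ (m +ℕ n) ≡ fromℕ m + fromℕ n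
  fromℕ-+ ℕ.zero    n = sym (+-identityˡ (fromℕ n))
  fromℕ-+ (ℕ.suc m) n = trans (cong (_+_ 1r) (fromℕ-+ m n)) (sym (+-assoc 1r (fromℕ m) (fromℕ n)))

  0≤fromℕ : ∀ n → 0r ≤ fromℕ n
  0≤fromℕ ℕ.zero    = inj₂ refl
  0≤fromℕ (ℕ.suc n) = inj₁ (subst (_< 1r + fromℕ n) (+-identityˡ 0r) (+-mono-<-≤ 0<1 (0≤fromℕ n)))

  fromℕ-mono-≤ : ∀ {m n} → m ≤ℕ n → fromℕ m ≤ fromℕ n
  fromℕ-mono-≤ {n = n} ℕ.z≤n = 0≤fromℕ n
  fromℕ-mono-≤ (ℕ.s≤s m≤n)   = +-mono-≤ (inj₂ refl) (fromℕ-mono-≤ m≤n)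

  fromℕ-+-mono-≤ : ∀ a b c d → a +ℕ b ≤ℕ c +ℕ d → fromℕ a + fromℕ b ≤ fromℕ c + fromℕ d
  fromℕ-+-mono-≤ a b c d = subst₂ _≤_ (fromℕ-+ a b) (fromℕ-+ c d) ∘ fromℕ-mono-≤

  fromℤ-⊖ : ∀ m k → fromℤ (m ℤ.⊖ k) + fromℕ k ≡ fromℕ m
  fromℤ-⊖ m         ℕ.zero    = +-identityʳ (fromℕ m)
  fromℤ-⊖ ℕ.zero    (ℕ.suc k) = -‿inverseˡ (fromℕ (ℕ.suc k))
  fromℤ-⊖ (ℕ.suc m) (ℕ.suc k) = begin
    fromℤ (ℕ.suc m ℤ.⊖ ℕ.suc k) + (1r + fromℕ k) ≡⟨ cong (λ z → fromℤ z + (1r + fromℕ k)) (ℤ.[1+m]⊖[1+n]≡m⊖n m k) ⟩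
    fromℤ (m ℤ.⊖ k) + (1r + fromℕ k)             ≡⟨ x∙yz≈y∙xz (fromℤ (m ℤ.⊖ k)) 1r (fromℕ k) ⟩
    1r + (fromℤ (m ℤ.⊖ k) + fromℕ k)             ≡⟨ cong (_+_ 1r) (fromℤ-⊖ m k) ⟩
    1r + fromℕ m                                 ∎
    where open ≡-Reasoning

  fromℤ[m-k]+k≡m : ∀ m k → fromℤ (+ m -ℤ + k) + fromℕ k ≡ fromℕ m
  fromℤ[m-k]+k≡m m k = trans (cong (λ z → fromℤ z + fromℕ k) (ℤ.m-n≡m⊖n m k)) (fromℤ-⊖ m k)

  ≡fromℤ[m-k]⇒+k≡m : ∀ {a} m k → a ≡ fromℤ (+ m -ℤ + k) → a + fromℕ k ≡ fromℕ m
  ≡fromℤ[m-k]⇒+k≡m m k refl = fromℤ[m-k]+k≡m m k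

  +k≡m⇒≡fromℤ[m-k] : ∀ {a} m k → a + fromℕ k ≡ fromℕ m → a ≡ fromℤ (+ m -ℤ + k)
  +k≡m⇒≡fromℤ[m-k] m k a+k≡m = +-cancelʳ (fromℕ k) _ _ (trans a+k≡m (sym (fromℤ[m-k]+k≡m m k)))

  fromℤ[m-k]≤⇒m≤+k : ∀ {a} m k → fromℤ (+ m -ℤ + k) ≤ a → fromℕ m ≤ a + fromℕ k
  fromℤ[m-k]≤⇒m≤+k m k m-k≤a = subst (_≤ _) (fromℤ[m-k]+k≡m m k) (+-mono-≤ m-k≤a (inj₂ refl))

  sumOver-modular : ∀ {n} (P Q : Subset n) x →
                    sumOver (P ∩ Q) x + sumOver (P ∪ Q) x ≡ sumOver P x + sumOver Q x
  sumOver-modular []      []      x = refl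
  sumOver-modular (p ∷ P) (q ∷ Q) x = modular-∷ p q
    where
    open ≡-Reasoning
    Σ : Subset _ → ℝ
    Σ A = sumOver A (x ∘ suc)

    modular : Σ (P ∩ Q) + Σ (P ∪ Q) ≡ Σ P + Σ Q
    modular = sumOver-modular P Q (x ∘ suc)

    modular-∷ : ∀ p q → sumOver ((p ∷ P) ∩ (q ∷ Q)) x + sumOver ((p ∷ P) ∪ (q ∷ Q)) x ≡
                        sumOver (p ∷ P) x + sumOver (q ∷ Q) x
    modular-∷ true true = begin
      (x zero + Σ (P ∩ Q)) + (x zero + Σ (P ∪ Q)) ≡⟨ interchange _ _ _ _ ⟩
      (x zero + x zero) + (Σ (P ∩ Q) + Σ (P ∪ Q)) ≡⟨ cong (_+_ (x zero + x zero)) modular ⟩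
      (x zero + x zero) + (Σ P + Σ Q)             ≡⟨ interchange _ _ _ _ ⟩
      (x zero + Σ P) + (x zero + Σ Q)             ∎
    modular-∷ true false = begin
      Σ (P ∩ Q) + (x zero + Σ (P ∪ Q))            ≡⟨ x∙yz≈y∙xz _ _ _ ⟩
      x zero + (Σ (P ∩ Q) + Σ (P ∪ Q))            ≡⟨ cong (_+_ (x zero)) modular ⟩
      x zero + (Σ P + Σ Q)                        ≡⟨ +-assoc _ _ _ ⟨
      (x zero + Σ P) + Σ Q                        ∎
    modular-∷ false true = begin
      Σ (P ∩ Q) + (x zero + Σ (P ∪ Q))            ≡⟨ x∙yz≈y∙xz _ _ _ ⟩
      x zero + (Σ (P ∩ Q) + Σ (P ∪ Q))            ≡⟨ cong (_+_ (x zero)) modular ⟩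
      x zero + (Σ P + Σ Q)                        ≡⟨ x∙yz≈y∙xz _ _ _ ⟩
      Σ P + (x zero + Σ Q)                        ∎
    modular-∷ false false = modular

  ≡⊎<⇒≤ : ∀ {A : Set} (f : A → ℝ) {P Q} → P ≡ Q ⊎ f P < f Q → f P ≤ f Q
  ≡⊎<⇒≤ f (inj₁ refl) = inj₂ refl
  ≡⊎<⇒≤ f (inj₂ fP<fQ) = inj₁ fP<fQ

  sumOver-⊆ : ∀ {n} {P Q : Subset n} x → (∀ i → i ∈ Q → 0r < x i) → P ⊆ Q →
              P ≡ Q ⊎ sumOver P x < sumOver Q x
  sumOver-⊆ {P = []} {[]} x _ _ = inj₁ refl
  sumOver-⊆ {P = p ∷ P} {q ∷ Q} x pos p∷P⊆q∷Q
    with sumOver-⊆ (x ∘ suc) (λ i → pos (suc i) ∘ there) (drop-∷-⊆ p∷P⊆q∷Q)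
  ... | tail with p | q
  ... | true  | true  = Sum.map (cong (true ∷_)) (+-monoʳ-< (x zero)) tail
  ... | false | false = Sum.map (cong (false ∷_)) id tail
  ... | false | true  = inj₂ (subst (_< _) (+-identityˡ _)
                          (+-mono-<-≤ (pos zero here) (≡⊎<⇒≤ (λ A → sumOver A (x ∘ suc)) tail)))
  ... | true  | false = contradiction (p∷P⊆q∷Q here) λ ()

  sumOver-uncrossing : ∀ {n} {A B C D : Subset n} x → (∀ i → i ∈ A ∪ B → 0r < x i) →
    Uncrossing A B C D →
    (sumOver C x + sumOver D x ≤ sumOver A x + sumOver B x) ×
    (sumOver C x + sumOver D x ≡ sumOver A x + sumOver B x → C ∩ D ≡ A ∩ B × C ∪ D ≡ A ∪ B)
  sumOver-uncrossing {A = A} {B} {C} {D} x pos u = sum-≤ , sum-≡⇒∩∪-≡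
    where
    open Uncrossing u
    Σ : Subset _ → ℝ
    Σ P = sumOver P x

    meet : C ∩ D ≡ A ∩ B ⊎ Σ (C ∩ D) < Σ (A ∩ B)
    meet = sumOver-⊆ x (λ i → pos i ∘ p⊆p∪q B ∘ p∩q⊆p A B) ∩⊆∩

    join : C ∪ D ≡ A ∪ B ⊎ Σ (C ∪ D) < Σ (A ∪ B)
    join = sumOver-⊆ x pos ∪⊆∪

    sum-≤ : Σ C + Σ D ≤ Σ A + Σ B
    sum-≤ = begin
      Σ C + Σ D                ≡⟨ sumOver-modular C D x ⟨
      Σ (C ∩ D) + Σ (C ∪ D)    ≤⟨ +-mono-≤ (≡⊎<⇒≤ Σ meet) (≡⊎<⇒≤ Σ join) ⟩
      Σ (A ∩ B) + Σ (A ∪ B)    ≡⟨ sumOver-modular A B x ⟩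
      Σ A + Σ B                ∎
      where open PosetReasoning ≤-poset

    ≡⊎<⇒≡ : ∀ {P Q} → P ≡ Q ⊎ Σ P < Σ Q → Σ P ≡ Σ Q → P ≡ Q
    ≡⊎<⇒≡ (inj₁ P≡Q)   _     = P≡Q
    ≡⊎<⇒≡ (inj₂ ΣP<ΣQ) ΣP≡ΣQ = contradiction ΣP<ΣQ (<-irrefl ΣP≡ΣQ)

    sum-≡⇒∩∪-≡ : Σ C + Σ D ≡ Σ A + Σ B → C ∩ D ≡ A ∩ B × C ∪ D ≡ A ∪ B
    sum-≡⇒∩∪-≡ sum-≡ with +-mono-≤-≡⇒≡ (≡⊎<⇒≤ Σ meet) (≡⊎<⇒≤ Σ join)
                         (trans (sumOver-modular C D x) (trans sum-≡ (sym (sumOver-modular A B x))))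
    ... | meet-≡ , join-≡ = ≡⊎<⇒≡ meet meet-≡ , ≡⊎<⇒≡ join join-≡

  uncrossing-squeeze : ∀ {sS sT sC sD fS fT fC fD rS rT rC rD} →
    sS + fS ≡ rS → sT + fT ≡ rT → rC ≤ sC + fC → rD ≤ sD + fD →
    sC + sD ≤ sS + sT → fC + fD ≤ fS + fT → rS + rT ≤ rC + rD →
    (rC ≡ sC + fC) × (rD ≡ sD + fD) × (sC + sD ≡ sS + sT)
  uncrossing-squeeze {sS} {sT} {sC} {sD} {fS} {fT} {fC} {fD} {rS} {rT} {rC} {rD}
                     tightS tightT feasibleC feasibleD s-uncross f-uncross supermodular =
    proj₁ r-tight , proj₂ r-tight , proj₁ (+-mono-≤-≡⇒≡ s-uncross f-uncross uncrossed≡crossed)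
    where
    open PosetReasoning ≤-poset

    crossed≤r : (sS + sT) + (fS + fT) ≤ rC + rD
    crossed≤r = begin
      (sS + sT) + (fS + fT)    ≡⟨ interchange sS sT fS fT ⟩
      (sS + fS) + (sT + fT)    ≡⟨ cong₂ _+_ tightS tightT ⟩
      rS + rT                  ≤⟨ supermodular ⟩
      rC + rD                  ∎

    r≤uncrossed : rC + rD ≤ (sC + sD) + (fC + fD)
    r≤uncrossed = begin
      rC + rD                  ≤⟨ +-mono-≤ feasibleC feasibleD ⟩
      (sC + fC) + (sD + fD)    ≡⟨ interchange sC fC sD fD ⟩
      (sC + sD) + (fC + fD)    ∎

    uncrossed≤crossed : (sC + sD) + (fC + fD) ≤ (sS + sT) + (fS + fT)
    uncrossed≤crossed = +-mono-≤ s-uncross f-uncross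

    uncrossed≡crossed : (sC + sD) + (fC + fD) ≡ (sS + sT) + (fS + fT)
    uncrossed≡crossed = ≤-antisym uncrossed≤crossed (≤-trans crossed≤r r≤uncrossed)

    r-tight : rC ≡ sC + fC × rD ≡ sD + fD
    r-tight = +-mono-≤-≡⇒≡ feasibleC feasibleD
      (trans (≤-antisym r≤uncrossed (≤-trans uncrossed≤crossed crossed≤r)) (interchange sC sD fC fD))

lemma6 : (R : RealField) → let open RealField R in
  (𝓕 : Set) (a₀ : 𝓕) (_⊑_ : 𝓕 → 𝓕 → Set) → IsPartialOrder _≡_ _⊑_ →
  (_∧_ _∨_ : 𝓕 → 𝓕 → 𝓕) →
  (∀ A B → (A ∧ B) ≡ (B ∧ A)) → (∀ A B → (A ∨ B) ≡ (B ∨ A)) →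
  (∀ A B → (A ∧ B) ⊑ A) → (∀ A B → A ⊑ (A ∨ B)) →
  (n : ℕ) (ρ : 𝓕 → Subset n) →
  (∀ A B C → A ⊑ B → B ⊑ C → (ρ A ∩ ρ C) ⊆ ρ B) →
  (∀ A B → (ρ (A ∨ B) ∪ ρ (A ∧ B)) ⊆ (ρ A ∪ ρ B)) →
  (r : 𝓕 → ℕ) →
  (∀ A B → (r A +ℕ r B) ≤ℕ (r (A ∧ B) +ℕ r (A ∨ B))) →
  (F E′ : Subset n) → (∀ e → e ∈ E′ → e ∉ F) →
  let r′ : 𝓕 → ℤ
      r′ S = (+ r S) -ℤ (+ ∣ F ∩ ρ S ∣)
  in
  (x : Fin n → ℝ) →
  (∀ S → fromℤ (r′ S) ≤ sumOver (ρ S ∩ E′) x) →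
  (∀ e → e ∈ E′ → 0r < x e) →
  (S T : 𝓕) →
  sumOver (ρ S ∩ E′) x ≡ fromℤ (r′ S) →
  sumOver (ρ T ∩ E′) x ≡ fromℤ (r′ T) →
  (sumOver (ρ (S ∧ T) ∩ E′) x ≡ fromℤ (r′ (S ∧ T))) ×
  (sumOver (ρ (S ∨ T) ∩ E′) x ≡ fromℤ (r′ (S ∨ T))) ×
  (∀ e → e ∈ E′ →
    (χ (ρ S ∩ E′) e +ℕ χ (ρ T ∩ E′) e) ≡ (χ (ρ (S ∧ T) ∩ E′) e +ℕ χ (ρ (S ∨ T) ∩ E′) e))
lemma6 R 𝓕 _ _⊑_ _ _∧_ _∨_ ∧-comm ∨-comm ∧-lowerˡ ∨-upperˡ n ρ consecutive submodular
       r supermodular F E′ _ x feasible positive S T tightS tightT =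
  +k≡m⇒≡fromℤ[m-k] (r (S ∧ T)) (∣ F ∩ ρ (S ∧ T) ∣) (sym (proj₁ squeeze)) ,
  +k≡m⇒≡fromℤ[m-k] (r (S ∨ T)) (∣ F ∩ ρ (S ∨ T) ∣) (sym (proj₁ (proj₂ squeeze))) ,
  λ e _ → χ-equality e
  where
  open RealField R
  open OrderedFieldProperties R

  s f : 𝓕 → ℝ
  s X = sumOver (ρ X ∩ E′) x
  f X = fromℕ ∣ F ∩ ρ X ∣

  uncrossing : Uncrossing (ρ S) (ρ T) (ρ (S ∧ T)) (ρ (S ∨ T))
  uncrossing = consecutive∧submodular⇒uncrossing _⊑_ _∧_ _∨_ ∧-comm ∨-comm ∧-lowerˡ ∨-upperˡ
                 ρ consecutive submodular S T

  positive-on-∪ : ∀ i → i ∈ (ρ S ∩ E′) ∪ (ρ T ∩ E′) → 0r < x i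
  positive-on-∪ i i∈ = positive i ([ p∩q⊆q (ρ S) E′ , p∩q⊆q (ρ T) E′ ]′ (x∈p∪q⁻ _ _ i∈))

  x-uncrossing : (s (S ∧ T) + s (S ∨ T) ≤ s S + s T) ×
                 (s (S ∧ T) + s (S ∨ T) ≡ s S + s T →
                  (ρ (S ∧ T) ∩ E′) ∩ (ρ (S ∨ T) ∩ E′) ≡ (ρ S ∩ E′) ∩ (ρ T ∩ E′) ×
                  (ρ (S ∧ T) ∩ E′) ∪ (ρ (S ∨ T) ∩ E′) ≡ (ρ S ∩ E′) ∪ (ρ T ∩ E′))
  x-uncrossing = sumOver-uncrossing x positive-on-∪ (Uncrossing-∩ʳ E′ uncrossing)

  f-uncrossing : f (S ∧ T) + f (S ∨ T) ≤ f S + f T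
  f-uncrossing = fromℕ-+-mono-≤ (∣ F ∩ ρ (S ∧ T) ∣) (∣ F ∩ ρ (S ∨ T) ∣) (∣ F ∩ ρ S ∣) (∣ F ∩ ρ T ∣)
                   (∣∣-uncrossing (Uncrossing-∩ˡ F uncrossing))

  r-supermodular : fromℕ (r S) + fromℕ (r T) ≤ fromℕ (r (S ∧ T)) + fromℕ (r (S ∨ T))
  r-supermodular = fromℕ-+-mono-≤ (r S) (r T) (r (S ∧ T)) (r (S ∨ T)) (supermodular S T)

  squeeze : (fromℕ (r (S ∧ T)) ≡ s (S ∧ T) + f (S ∧ T)) ×
            (fromℕ (r (S ∨ T)) ≡ s (S ∨ T) + f (S ∨ T)) ×
            (s (S ∧ T) + s (S ∨ T) ≡ s S + s T)
  squeeze = uncrossing-squeeze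
    (≡fromℤ[m-k]⇒+k≡m (r S) (∣ F ∩ ρ S ∣) tightS)
    (≡fromℤ[m-k]⇒+k≡m (r T) (∣ F ∩ ρ T ∣) tightT)
    (fromℤ[m-k]≤⇒m≤+k (r (S ∧ T)) (∣ F ∩ ρ (S ∧ T) ∣) (feasible (S ∧ T)))
    (fromℤ[m-k]≤⇒m≤+k (r (S ∨ T)) (∣ F ∩ ρ (S ∨ T) ∣) (feasible (S ∨ T)))
    (proj₁ x-uncrossing)
    f-uncrossing
    r-supermodular

  χ-equality : ∀ e → χ (ρ S ∩ E′) e +ℕ χ (ρ T ∩ E′) e ≡ χ (ρ (S ∧ T) ∩ E′) e +ℕ χ (ρ (S ∨ T) ∩ E′) e
  χ-equality with proj₂ x-uncrossing (proj₂ (proj₂ squeeze))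
  ... | meet-≡ , join-≡ = ∩-∪-determine-χ+χ meet-≡ join-≡
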